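{- Let $G$ be a graph on $n$ vertices with a tree decomposition $T$ of treewidth $w$, and let $v_0\in V(G)$. Then the depth of the recursive decomposition $\mathcal{R}(\emptyset, v_0)$ is at most $\log n$. Moreover, for every node $\langle Z,r\rangle$ of $\mathcal{R}(\emptyset,v_0)$ we have $|Z|\le 4w+4$.
   Context: Graphs are treated as undirected; $\log$ is base 2. A tree decomposition of $G$ is a tree $T$ with bags $B(t)\subseteq V(G)$ such that every vertex is in some bag, every edge has both endpoints in some bag, and if $t_3$ lies on the path from $t_1$ to $t_2$ then $B(t_1)\cap B(t_2)\subseteq B(t_3)$; treewidth is $\max_t(|B(t)|-1)$. For $W\subseteq V(G)$, a vertex separator of $W$ is a set $S$ such that every component of $G[V(G)\setminus S]$ contains at most $|W|/2$ vertices of $W$; $\mathsf{sep}(W)$ denotes a fixed choice of a bag $B(t)$ of $T$ that is a vertex separator of $W$ (such a bag always exists; e.g. the first such bag in a fixed enumeration of the nodes of $T$), so $|\mathsf{sep}(W)|\le w+1$. For $Z\subseteq V(G)$ and $r\in V(G)\setminus Z$, $G_{Z,r}$ denotes the subgraph of $G$ induced by the connected component of $G[V(G)\setminus Z]$ containing $r$. The recursive decomposition $\mathcal{R}(Z,r)$ is the rooted tree defined as follows: its root is $\langle Z,r\rangle$; let $Z'=Z\cup\mathsf{sep}(Z)\cup\mathsf{sep}(V(G_{Z,r}))$ and let $r_1,\dots,r_k$ be the lowest-indexed vertices of the connected components of $G[V(G_{Z,r})\setminus Z']$; the children of the root are the roots of $\mathcal{R}(Z'_i,r_i)$, $i=1,\dots,k$,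 where $Z'_i$ is the set of vertices of $Z'$ adjacent in $G$ to at least one vertex of $V(G_{Z',r_i})$. -}

module Defs where

open import Data.Nat using (ℕ; zero; suc; _+_; _*_; _≤_)
open import Data.Bool using (Bool; true; false; _∧_)
open import Data.Fin using (Fin; toℕ)
open import Data.Fin.Subset using (Subset; _∈_; _∉_; _∪_; _∩_; ∁; ⁅_⁆; ∣_∣; ⊥)
open import Data.Vec using (tabulate; lookup)
open import Data.List using (List; []; _∷_)
open import Data.List.Relation.Unary.Unique.Propositional using (Unique)
open import Data.List.Membership.Propositional using () renaming (_∈_ to _∈ₗ_)
open import Data.Product using (Σ; ∃; _×_)
open import Relation.Binary.PropositionalEquality using (_≡_)
open import Function using (_∘_)

Adj : ℕ → Set
Adj n = Fin n → Fin n → Bool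

Symmetric : ∀ {n} → Adj n → Set
Symmetric {n} A = (u v : Fin n) → A u v ≡ true → A v u ≡ true

Irreflexive : ∀ {n} → Adj n → Set
Irreflexive {n} A = (u : Fin n) → A u u ≡ false

anyFin : ∀ {n} → (Fin n → Bool) → Bool
anyFin {zero}  f = false
anyFin {suc n} f = Data.Bool._∨_ (f Fin.zero) (anyFin (f ∘ Fin.suc))
  where import Data.Fin as Fin

step : ∀ {n} → Adj n → Subset n → Subset n → Subset n
step A X R = R ∪ tabulate (λ u → lookup X u ∧ anyFin (λ v → lookup R v ∧ A v u))

iter : ∀ {n} → ℕ → (Subset n → Subset n) → Subset n → Subset n
iter zero    f R = R
iter (suc k) f R = f (iter k f R)

-- comp A X r : the vertex set of the connected component of G[X] containing r
-- (the set of vertices reachable from r by a walk inside X; n BFS rounds suffice).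
-- Empty if r ∉ X.
comp : ∀ {n} → Adj n → Subset n → Fin n → Subset n
comp {n} A X r = iter n (step A X) (⁅ r ⁆ ∩ X)

IsVertexSeparator : ∀ {n} → Adj n → Subset n → Subset n → Set
IsVertexSeparator {n} A S W =
  (v : Fin n) → v ∉ S → 2 * ∣ comp A (∁ S) v ∩ W ∣ ≤ ∣ W ∣

data Walk {m : ℕ} (A : Adj m) : Fin m → Fin m → List (Fin m) → Set where
  here  : ∀ t → Walk A t t (t ∷ [])
  cons  : ∀ {s u t p} → A s u ≡ true → Walk A u t p → Walk A s t (s ∷ p)

Path : ∀ {m} → Adj m → Fin m → Fin m → List (Fin m) → Set
Path A s t p = Walk A s t p × Unique p

IsTree : ∀ {m} → Adj m → Set
IsTree {m} A =
  Symmetric A × Irreflexive A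
  × ((s t : Fin m) → ∃ λ p → Path A s t p)
  × ((s t : Fin m) (p q : List (Fin m)) → Path A s t p → Path A s t q → p ≡ q)

OnPath : ∀ {m} → Adj m → Fin m → Fin m → Fin m → Set
OnPath A t₁ t₂ t₃ = ∃ λ p → Path A t₁ t₂ p × t₃ ∈ₗ p

record IsTreeDecomposition {n m : ℕ} (A : Adj n) (TA : Adj m)
       (B : Fin m → Subset n) (w : ℕ) : Set where
  field
    tree     : IsTree TA
    vertices : (v : Fin n) → ∃ λ t → v ∈ B t
    edges    : (u v : Fin n) → A u v ≡ true → ∃ λ t → u ∈ B t × v ∈ B t
    interp   : (t₁ t₂ t₃ : Fin m) → OnPath TA t₁ t₂ t₃ →
               (v : Fin n) → v ∈ B t₁ → v ∈ B t₂ → v ∈ B t₃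
    width≤   : (t : Fin m) → ∣ B t ∣ ≤ suc w
    width≡   : ∃ λ t → ∣ B t ∣ ≡ suc w

-- The recursive decomposition R(∅, v₀), given the choice function sep
-- (sep W is a node of T whose bag is a vertex separator of W).
-- RNode A B sep v₀ Z r d : ⟨Z , r⟩ is a node of R(∅, v₀) at depth d
-- (the root has depth 0).

module _ {n m : ℕ} (A : Adj n) (B : Fin m → Subset n) (sep : Subset n → Fin m) where

  VG : Subset n → Fin n → Subset n
  VG Z r = comp A (∁ Z) r

  Z′ : Subset n → Fin n → Subset n
  Z′ Z r = Z ∪ B (sep Z) ∪ B (sep (VG Z r))

  -- r' is the lowest-indexed vertex of a component of G[V(G_{Z,r}) ∖ Z']
  IsChildRoot : Subset n → Fin n → Fin n → Set
  IsChildRoot Z r r′ =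
    let X = VG Z r ∩ ∁ (Z′ Z r) in
    r′ ∈ X × ((u : Fin n) → u ∈ comp A X r′ → toℕ r′ Data.Nat.≤ toℕ u)

  childZ : Subset n → Fin n → Fin n → Subset n
  childZ Z r r′ = Z′ Z r ∩ tabulate (λ z → anyFin (λ u → lookup (VG (Z′ Z r) r′) u ∧ A z u))

  data RNode (v₀ : Fin n) : Subset n → Fin n → ℕ → Set where
    root  : RNode v₀ ⊥ v₀ zero
    child : ∀ {Z r d r′} → RNode v₀ Z r d → IsChildRoot Z r r′ →
            RNode v₀ (childZ Z r r′) r′ (suc d)

-- Along every root-to-leaf branch of R(∅, v₀) the invariant
--   r ∉ Z,   2^d · |V(G_{Z,r})| ≤ n,   |Z| ≤ 4w + 4
-- is preserved. A child component G_{Z'ᵢ,rᵢ} lies inside G_{Z,r} and avoids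
-- sep(V(G_{Z,r})), so it holds at most half of V(G_{Z,r}); this halving bounds
-- the depth by log n. A vertex of Z'ᵢ outside the two new bags is a vertex of Z
-- adjacent to G_{Z'ᵢ,rᵢ}, hence in the component of G − sep(Z) containing rᵢ;
-- there are at most |Z|/2 ≤ 2w + 2 of those, giving |Z'ᵢ| ≤ 4w + 4.
module Submission where

open import Defs
open import Data.Nat using (ℕ; zero; suc; _+_; _*_; _^_; _≤_; z≤n; s≤s)
open import Data.Nat.Properties
  using (≤-trans; ≤-antisym; ≤-<-trans; ≤-reflexive; +-identityʳ; *-identityʳ; +-suc;
         +-mono-≤; +-monoʳ-≤; *-monoʳ-≤; *-cancelˡ-≤; *-assoc; *-comm; module ≤-Reasoning)
open import Data.Nat.Logarithm using (⌊log₂_⌋; ⌊log₂⌋-mono-≤; ⌊log₂[2^n]⌋≡n)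
open import Data.Nat.Tactic.RingSolver using (solve-∀)
open import Data.Bool using (Bool; true; false; _∧_; _∨_)
open import Data.Bool.Properties using (∧-conicalˡ; ∧-conicalʳ; ∨-zeroʳ)
open import Data.Fin using (Fin; zero; suc)
open import Data.Fin.Subset
  using (Subset; _∈_; _∉_; _⊆_; _⊂_; _∪_; _∩_; ∁; ⁅_⁆; ⊥; ∣_∣; inside; outside)
open import Data.Fin.Subset.Properties
  using (_∈?_; _⊂?_; ∈⊤; ∉⊥; ∣⊥∣≡0; ∣p∣≤n; ∣p∣≤∣x∷p∣; ∣p∣≡n⇒p≡⊤; p⊆q⇒∣p∣≤∣q∣;
         p⊂q⇒∣p∣<∣q∣; ⊆-min; p⊆p∪q; q⊆p∪q; x∈p∪q⁻; x∈p∪q⁺; x∈p∩q⁻; x∈p∩q⁺;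
         x∈⁅x⁆; x∈⁅y⁆⇒x≡y; p⊆q⇒∁p⊇∁q; x∉p⇒x∈∁p; x∈∁p⇒x∉p)
open import Data.Vec using ([]; _∷_; lookup; tabulate)
open import Data.Vec.Properties using ([]=⇒lookup; lookup⇒[]=; lookup∘tabulate)
open import Data.Product using (∃; _×_; _,_; proj₁; proj₂)
open import Data.Sum using (_⊎_; inj₁; inj₂)
open import Data.Empty using (⊥-elim)
open import Relation.Nullary using (¬_; yes; no; contradiction)
open import Relation.Binary.PropositionalEquality
  using (_≡_; refl; sym; trans; cong; cong₂; subst)
open import Function using (_∘_; id)

∈-tabulate⁻ : ∀ {n} (g : Fin n → Bool) {x} → x ∈ tabulate g → g x ≡ true
∈-tabulate⁻ g {x} x∈ = trans (sym (lookup∘tabulate g x)) ([]=⇒lookup x∈)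

∈-tabulate⁺ : ∀ {n} (g : Fin n → Bool) {x} → g x ≡ true → x ∈ tabulate g
∈-tabulate⁺ g {x} gx = lookup⇒[]= x _ (trans (lookup∘tabulate g x) gx)

anyFin⁻ : ∀ {n} (f : Fin n → Bool) → anyFin f ≡ true → ∃ λ i → f i ≡ true
anyFin⁻ {zero}  f ()
anyFin⁻ {suc n} f any with f zero in f0
... | true  = zero , f0
... | false = let i , fi = anyFin⁻ (f ∘ suc) any in suc i , fi

anyFin⁺ : ∀ {n} (f : Fin n → Bool) i → f i ≡ true → anyFin f ≡ true
anyFin⁺ f zero    fi rewrite fi = refl
anyFin⁺ f (suc i) fi = trans (cong (f zero ∨_) (anyFin⁺ (f ∘ suc) i fi)) (∨-zeroʳ (f zero))

∣p∪q∣≤∣p∣+∣q∣ : ∀ {n} (p q : Subset n) → ∣ p ∪ q ∣ ≤ ∣ p ∣ + ∣ q ∣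
∣p∪q∣≤∣p∣+∣q∣ []            []            = z≤n
∣p∪q∣≤∣p∣+∣q∣ (inside ∷ p)  (s ∷ q)       =
  s≤s (≤-trans (∣p∪q∣≤∣p∣+∣q∣ p q) (+-monoʳ-≤ ∣ p ∣ (∣p∣≤∣x∷p∣ s q)))
∣p∪q∣≤∣p∣+∣q∣ (outside ∷ p) (outside ∷ q) = ∣p∪q∣≤∣p∣+∣q∣ p q
∣p∪q∣≤∣p∣+∣q∣ (outside ∷ p) (inside ∷ q)  =
  ≤-trans (s≤s (∣p∪q∣≤∣p∣+∣q∣ p q)) (≤-reflexive (sym (+-suc ∣ p ∣ ∣ q ∣)))

module _ {n : ℕ} (f : Subset n → Subset n) (f-mono : ∀ {p q} → p ⊆ q → f p ⊆ f q) where

  iter-⊆ : ∀ k {R P} → R ⊆ P → f P ⊆ P → iter k f R ⊆ P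
  iter-⊆ zero    R⊆P fP⊆P = R⊆P
  iter-⊆ (suc k) R⊆P fP⊆P = fP⊆P ∘ f-mono (iter-⊆ k R⊆P fP⊆P)

  module _ (f-inflationary : ∀ p → p ⊆ f p) where

    iter-inflationary : ∀ k R → R ⊆ iter k f R
    iter-inflationary zero    R = id
    iter-inflationary (suc k) R = f-inflationary _ ∘ iter-inflationary k R

    ¬⊂f⇒closed : ∀ {p} → ¬ (p ⊂ f p) → f p ⊆ p
    ¬⊂f⇒closed {p} ¬p⊂fp {x} x∈fp with x ∈? p
    ... | yes x∈p = x∈p
    ... | no  x∉p = ⊥-elim (¬p⊂fp (f-inflationary p , x , x∈fp , x∉p))

    iter-grows-or-closed : ∀ k R → k ≤ ∣ iter k f R ∣ ⊎ f (iter k f R) ⊆ iter k f R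
    iter-grows-or-closed zero    R = inj₁ z≤n
    iter-grows-or-closed (suc k) R with iter-grows-or-closed k R
    ... | inj₂ closed = inj₂ (f-mono closed)
    ... | inj₁ k≤ with iter k f R ⊂? f (iter k f R)
    ...   | yes grows = inj₁ (≤-<-trans k≤ (p⊂q⇒∣p∣<∣q∣ grows))
    ...   | no  stuck = inj₂ (f-mono (¬⊂f⇒closed stuck))

    iter-n-closed : ∀ R → f (iter n f R) ⊆ iter n f R
    iter-n-closed R {x} x∈ with iter-grows-or-closed n R
    ... | inj₂ closed = closed x∈
    ... | inj₁ n≤ = subst (x ∈_) (sym full) ∈⊤
      where full = ∣p∣≡n⇒p≡⊤ (≤-antisym (∣p∣≤n (iter n f R)) n≤)

module Components {n : ℕ} (A : Adj n) where

  ∈-step⁻ : ∀ {X R x} → x ∈ step A X R →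
            x ∈ R ⊎ (x ∈ X × ∃ λ v → v ∈ R × A v x ≡ true)
  ∈-step⁻ {X} {R} {x} x∈ with x∈p∪q⁻ R _ x∈
  ... | inj₁ x∈R = inj₁ x∈R
  ... | inj₂ x∈new =
    let g≡ = ∈-tabulate⁻ _ x∈new
        v , v∧ = anyFin⁻ _ (∧-conicalʳ _ _ g≡)
    in inj₂ (lookup⇒[]= x X (∧-conicalˡ _ _ g≡) ,
             v , lookup⇒[]= v R (∧-conicalˡ _ _ v∧) , ∧-conicalʳ _ _ v∧)

  ∈-step⁺ : ∀ {X R x v} → x ∈ X → v ∈ R → A v x ≡ true → x ∈ step A X R
  ∈-step⁺ {X} {R} {x} {v} x∈X v∈R Avx = x∈p∪q⁺ (inj₂ (∈-tabulate⁺ _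
    (cong₂ _∧_ ([]=⇒lookup x∈X) (anyFin⁺ _ v (cong₂ _∧_ ([]=⇒lookup v∈R) Avx)))))

  step-inflationary : ∀ X R → R ⊆ step A X R
  step-inflationary X R = p⊆p∪q _

  step-mono : ∀ {X X′ R R′} → X ⊆ X′ → R ⊆ R′ → step A X R ⊆ step A X′ R′
  step-mono {X′ = X′} {R′ = R′} X⊆ R⊆ x∈ with ∈-step⁻ x∈
  ... | inj₁ x∈R = step-inflationary X′ R′ (R⊆ x∈R)
  ... | inj₂ (x∈X , v , v∈R , Avx) = ∈-step⁺ (X⊆ x∈X) (R⊆ v∈R) Avx

  comp-⊆ : ∀ {X r P} → r ∈ P → step A X P ⊆ P → comp A X r ⊆ P
  comp-⊆ {X} {r} {P} r∈P closed = iter-⊆ (step A X) (step-mono {X} id) n seed⊆P closed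
    where
    seed⊆P : ⁅ r ⁆ ∩ X ⊆ P
    seed⊆P x∈ with x∈⁅y⁆⇒x≡y r (proj₁ (x∈p∩q⁻ _ _ x∈))
    ... | refl = r∈P

  r∈comp : ∀ {X r} → r ∈ X → r ∈ comp A X r
  r∈comp {X} {r} r∈X =
    iter-inflationary (step A X) (step-mono {X} id) (step-inflationary X) n _ (x∈p∩q⁺ (x∈⁅x⁆ r , r∈X))

  comp-step-closed : ∀ X r → step A X (comp A X r) ⊆ comp A X r
  comp-step-closed X r = iter-n-closed (step A X) (step-mono {X} id) (step-inflationary X) _

  comp-closed : ∀ {X r u v} → u ∈ comp A X r → v ∈ X → A u v ≡ true → v ∈ comp A X r
  comp-closed {X} {r} u∈ v∈X Auv = comp-step-closed X r (∈-step⁺ v∈X u∈ Auv)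

  comp-⊆-comp : ∀ {X X′ r r′} → X′ ⊆ X → r′ ∈ comp A X r → comp A X′ r′ ⊆ comp A X r
  comp-⊆-comp {X} {r = r} X′⊆X r′∈ =
    comp-⊆ r′∈ (comp-step-closed X r ∘ step-mono X′⊆X id)

  comp-⊆-comp-if-closed : ∀ {X Y r} → r ∈ Y →
    (∀ {u v} → u ∈ comp A Y r → v ∈ X → A u v ≡ true → v ∈ Y) →
    comp A X r ⊆ comp A Y r
  comp-⊆-comp-if-closed {X} {Y} {r} r∈Y exits-into-Y = comp-⊆ (r∈comp r∈Y) closed
    where
    closed : step A X (comp A Y r) ⊆ comp A Y r
    closed x∈ with ∈-step⁻ x∈
    ... | inj₁ x∈C = x∈C
    ... | inj₂ (x∈X , v , v∈C , Avx) = comp-closed v∈C (exits-into-Y v∈C x∈X Avx) Avx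

2^d≤n⇒d≤⌊log₂n⌋ : ∀ {d n} → 2 ^ d ≤ n → d ≤ ⌊log₂ n ⌋
2^d≤n⇒d≤⌊log₂n⌋ {d} {n} 2^d≤n = subst (_≤ ⌊log₂ n ⌋) (⌊log₂[2^n]⌋≡n d) (⌊log₂⌋-mono-≤ 2^d≤n)

m+m≡2*m : ∀ m → m + m ≡ 2 * m
m+m≡2*m m = cong (m +_) (sym (+-identityʳ m))

4w+4≡2*[2*[1+w]] : ∀ w → 4 * w + 4 ≡ 2 * (2 * suc w)
4w+4≡2*[2*[1+w]] = solve-∀

module RecursiveDecomposition
  {n m w : ℕ} (A : Adj n) (symA : Symmetric A) (B : Fin m → Subset n)
  (bag-size : ∀ t → ∣ B t ∣ ≤ suc w) (sep : Subset n → Fin m)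
  (separates : ∀ W → IsVertexSeparator A (B (sep W)) W) where

  open Components A

  Invariant : Subset n → Fin n → ℕ → Set
  Invariant Z r d = r ∉ Z × 2 ^ d * ∣ VG A B sep Z r ∣ ≤ n × ∣ Z ∣ ≤ 4 * w + 4

  module Child (Z : Subset n) (r r′ : Fin n)
    (r′∈VG : r′ ∈ VG A B sep Z r) (r′∉Z′ : r′ ∉ Z′ A B sep Z r) where

    Zᵢ S₀ S₁ : Subset n
    Zᵢ = childZ A B sep Z r r′
    S₀ = B (sep Z)
    S₁ = B (sep (VG A B sep Z r))

    Z⊆Z′ : Z ⊆ Z′ A B sep Z r
    Z⊆Z′ = p⊆p∪q _

    S₀⊆Z′ : S₀ ⊆ Z′ A B sep Z r
    S₀⊆Z′ = q⊆p∪q Z _ ∘ p⊆p∪q S₁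

    S₁⊆Z′ : S₁ ⊆ Z′ A B sep Z r
    S₁⊆Z′ = q⊆p∪q Z _ ∘ q⊆p∪q S₀ S₁

    ∈Zᵢ⁻ : ∀ {z} → z ∈ Zᵢ →
           z ∈ Z′ A B sep Z r × ∃ λ u → u ∈ VG A B sep (Z′ A B sep Z r) r′ × A z u ≡ true
    ∈Zᵢ⁻ z∈ =
      let z∈Z′ , z∈adj = x∈p∩q⁻ _ _ z∈
          u , u∧ = anyFin⁻ _ (∈-tabulate⁻ _ z∈adj)
      in z∈Z′ , u , lookup⇒[]= u _ (∧-conicalˡ _ _ u∧) , ∧-conicalʳ _ _ u∧

    ∈Zᵢ⁺ : ∀ {z u} → z ∈ Z′ A B sep Z r → u ∈ VG A B sep (Z′ A B sep Z r) r′ →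
           A z u ≡ true → z ∈ Zᵢ
    ∈Zᵢ⁺ {u = u} z∈Z′ u∈ Azu =
      x∈p∩q⁺ (z∈Z′ , ∈-tabulate⁺ _ (anyFin⁺ _ u (cong₂ _∧_ ([]=⇒lookup u∈) Azu)))

    r′∉Zᵢ : r′ ∉ Zᵢ
    r′∉Zᵢ = r′∉Z′ ∘ proj₁ ∘ ∈Zᵢ⁻

    VG-Z′⊆comp : ∀ {S} → S ⊆ Z′ A B sep Z r → r′ ∉ S →
                 VG A B sep (Z′ A B sep Z r) r′ ⊆ comp A (∁ S) r′
    VG-Z′⊆comp S⊆Z′ r′∉S = comp-⊆-comp (p⊆q⇒∁p⊇∁q S⊆Z′) (r∈comp (x∉p⇒x∈∁p r′∉S))

    -- Leaving the component of r′ in G − Z′ through Z′ means entering Zᵢ.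
    VGᵢ⊆VG-Z′ : VG A B sep Zᵢ r′ ⊆ VG A B sep (Z′ A B sep Z r) r′
    VGᵢ⊆VG-Z′ = comp-⊆-comp-if-closed (x∉p⇒x∈∁p r′∉Z′) stays
      where
      stays : ∀ {u v} → u ∈ VG A B sep (Z′ A B sep Z r) r′ → v ∈ ∁ Zᵢ → A u v ≡ true →
              v ∈ ∁ (Z′ A B sep Z r)
      stays {v = v} u∈ v∉Zᵢ Auv with v ∈? Z′ A B sep Z r
      ... | no  v∉Z′ = x∉p⇒x∈∁p v∉Z′
      ... | yes v∈Z′ = contradiction (∈Zᵢ⁺ v∈Z′ u∈ (symA _ _ Auv)) (x∈∁p⇒x∉p v∉Zᵢ)

    VGᵢ-halves : 2 * ∣ VG A B sep Zᵢ r′ ∣ ≤ ∣ VG A B sep Z r ∣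
    VGᵢ-halves = ≤-trans (*-monoʳ-≤ 2 (p⊆q⇒∣p∣≤∣q∣ VGᵢ⊆))
                         (separates _ r′ (r′∉Z′ ∘ S₁⊆Z′))
      where
      VGᵢ⊆ : VG A B sep Zᵢ r′ ⊆ comp A (∁ S₁) r′ ∩ VG A B sep Z r
      VGᵢ⊆ x∈ = let x∈C = VGᵢ⊆VG-Z′ x∈ in
        x∈p∩q⁺ (VG-Z′⊆comp S₁⊆Z′ (r′∉Z′ ∘ S₁⊆Z′) x∈C ,
                comp-⊆-comp (p⊆q⇒∁p⊇∁q Z⊆Z′) r′∈VG x∈C)

    Zᵢ⊆ : Zᵢ ⊆ (comp A (∁ S₀) r′ ∩ Z) ∪ (S₀ ∪ S₁)
    Zᵢ⊆ {z} z∈ with ∈Zᵢ⁻ z∈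
    ... | z∈Z′ , u , u∈C , Azu with x∈p∪q⁻ Z (S₀ ∪ S₁) z∈Z′
    ...   | inj₂ z∈S = x∈p∪q⁺ (inj₂ z∈S)
    ...   | inj₁ z∈Z with z ∈? S₀
    ...     | yes z∈S₀ = x∈p∪q⁺ (inj₂ (x∈p∪q⁺ (inj₁ z∈S₀)))
    ...     | no  z∉S₀ = x∈p∪q⁺ (inj₁ (x∈p∩q⁺ (z∈D , z∈Z)))
      where
      z∈D : z ∈ comp A (∁ S₀) r′
      z∈D = comp-closed (VG-Z′⊆comp S₀⊆Z′ (r′∉Z′ ∘ S₀⊆Z′) u∈C)
                        (x∉p⇒x∈∁p z∉S₀) (symA _ _ Azu)

    ∣Zᵢ∣≤ : ∣ Z ∣ ≤ 4 * w + 4 → ∣ Zᵢ ∣ ≤ 4 * w + 4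
    ∣Zᵢ∣≤ ∣Z∣≤ = begin
      ∣ Zᵢ ∣                                 ≤⟨ p⊆q⇒∣p∣≤∣q∣ Zᵢ⊆ ⟩
      ∣ (D ∩ Z) ∪ (S₀ ∪ S₁) ∣                ≤⟨ ∣p∪q∣≤∣p∣+∣q∣ (D ∩ Z) _ ⟩
      ∣ D ∩ Z ∣ + ∣ S₀ ∪ S₁ ∣                ≤⟨ +-mono-≤ half-Z two-bags ⟩
      2 * suc w + 2 * suc w                  ≡⟨ m+m≡2*m (2 * suc w) ⟩
      2 * (2 * suc w)                        ≡⟨ sym (4w+4≡2*[2*[1+w]] w) ⟩
      4 * w + 4                              ∎
      where
      open ≤-Reasoning
      D : Subset n
      D = comp A (∁ S₀) r′
      half-Z : ∣ D ∩ Z ∣ ≤ 2 * suc w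
      half-Z = *-cancelˡ-≤ 2 (≤-trans (separates Z r′ (r′∉Z′ ∘ S₀⊆Z′))
                             (≤-trans ∣Z∣≤ (≤-reflexive (4w+4≡2*[2*[1+w]] w))))
      two-bags : ∣ S₀ ∪ S₁ ∣ ≤ 2 * suc w
      two-bags = ≤-trans (∣p∪q∣≤∣p∣+∣q∣ S₀ S₁)
        (≤-trans (+-mono-≤ (bag-size _) (bag-size _))
                 (≤-reflexive (m+m≡2*m (suc w))))

  invariant-child : ∀ {Z r d r′} → Invariant Z r d → IsChildRoot A B sep Z r r′ →
                    Invariant (childZ A B sep Z r r′) r′ (suc d)
  invariant-child {Z} {r} {d} {r′} (_ , size , ∣Z∣≤) (r′∈ , _) =
    r′∉Zᵢ , size′ , ∣Zᵢ∣≤ ∣Z∣≤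
    where
    open Child Z r r′ (proj₁ (x∈p∩q⁻ _ _ r′∈)) (x∈∁p⇒x∉p (proj₂ (x∈p∩q⁻ _ _ r′∈)))
    open ≤-Reasoning
    size′ : 2 ^ suc d * ∣ VG A B sep Zᵢ r′ ∣ ≤ n
    size′ = begin
      2 * 2 ^ d * ∣ VG A B sep Zᵢ r′ ∣       ≡⟨ cong (_* ∣ VG A B sep Zᵢ r′ ∣) (*-comm 2 (2 ^ d)) ⟩
      2 ^ d * 2 * ∣ VG A B sep Zᵢ r′ ∣       ≡⟨ *-assoc (2 ^ d) 2 _ ⟩
      2 ^ d * (2 * ∣ VG A B sep Zᵢ r′ ∣)     ≤⟨ *-monoʳ-≤ (2 ^ d) VGᵢ-halves ⟩
      2 ^ d * ∣ VG A B sep Z r ∣             ≤⟨ size ⟩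
      n                                      ∎

  invariant : ∀ {v₀ Z r d} → RNode A B sep v₀ Z r d → Invariant Z r d
  invariant {v₀} root =
    ∉⊥ , ≤-trans (≤-reflexive (+-identityʳ _)) (∣p∣≤n (VG A B sep ⊥ v₀)) ,
    subst (_≤ 4 * w + 4) (sym (∣⊥∣≡0 n)) z≤n
  invariant (child {d = d} node is-child) = invariant-child {d = d} (invariant node) is-child

  depth≤log : ∀ {Z r d} → Invariant Z r d → d ≤ ⌊log₂ n ⌋
  depth≤log {Z} {r} {d} (r∉Z , size , _) = 2^d≤n⇒d≤⌊log₂n⌋ (begin
    2 ^ d                        ≡⟨ sym (*-identityʳ (2 ^ d)) ⟩
    2 ^ d * 1                    ≤⟨ *-monoʳ-≤ (2 ^ d) nonempty ⟩
    2 ^ d * ∣ VG A B sep Z r ∣   ≤⟨ size ⟩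
    n                            ∎)
    where
    open ≤-Reasoning
    nonempty : 1 ≤ ∣ VG A B sep Z r ∣
    nonempty = subst (λ k → suc k ≤ ∣ VG A B sep Z r ∣) (∣⊥∣≡0 n)
                     (p⊂q⇒∣p∣<∣q∣ (⊆-min _ , r , r∈comp (x∉p⇒x∈∁p r∉Z) , ∉⊥))

lemma3 : (n m w : ℕ) (A : Adj n) → Symmetric A →
    (TA : Adj m) (B : Fin m → Subset n) → IsTreeDecomposition A TA B w →
    (sep : Subset n → Fin m) →
    ((W : Subset n) → IsVertexSeparator A (B (sep W)) W) →
    (v₀ : Fin n) →
    ((Z : Subset n) (r : Fin n) (d : ℕ) → RNode A B sep v₀ Z r d →
    d ≤ ⌊log₂ n ⌋ × ∣ Z ∣ ≤ 4 * w + 4)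
lemma3 n m w A symA TA B td sep separates v₀ Z r d node =
  depth≤log inv , proj₂ (proj₂ inv)
  where
  open RecursiveDecomposition A symA B (IsTreeDecomposition.width≤ td) sep separates
  inv : Invariant Z r d
  inv = invariant node
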